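{- If $R$ is a ceer such that $R\equiv_{\mathrm{c}} R\oplus \Id_\omega$, then there is a c.e.\ semigroup $S$ generated by two elements such that ${=_S}\equiv_{\mathrm{c}} R$.
   Context: A ceer is a computably enumerable equivalence relation on $\omega$. For equivalence relations $R,S$ on $\omega$, $R\le_{\mathrm{c}} S$ means there is a computable $f$ with $x\mathrel{R}y\Leftrightarrow f(x)\mathrel{S}f(y)$; $R\equiv_{\mathrm{c}} S$ means both $R\le_{\mathrm{c}} S$ and $S\le_{\mathrm{c}} R$. $\Id_\omega$ is the equality relation on $\omega$. The uniform join of $U,V$ is $U\oplus V=\{(2x,2y):x\mathrel{U}y\}\cup\{(2x+1,2y+1):x\mathrel{V}y\}$. A two-generator c.e.\ semigroup $S$ is a quotient of the free semigroup $X^+$ on $X=\{a,b\}$ (identified with $\omega$ via a fixed computable coding) by a congruence $=_S$ which is c.e.; $=_S$ is its word problem. -}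

module Defs where

open import Data.Nat using (ℕ; zero; suc; _+_; _*_; _∸_; _<_)
open import Data.Fin using (Fin)
open import Data.Vec using (Vec; []; _∷_; lookup)
open import Data.Bool using (Bool; true; false)
open import Data.List.NonEmpty using (List⁺; _∷_; _⁺++⁺_)
open import Data.List using (List; []; _∷_)
open import Data.Product using (Σ; ∃; _×_; _,_)
open import Data.Sum using (_⊎_)
open import Relation.Binary.PropositionalEquality using (_≡_)
open import Relation.Binary.Structures using (IsEquivalence)
open import Function.Bundles using (_⇔_)

data PR : ℕ → Set where
  zer  : ∀ {n} → PR n
  succ : PR 1
  proj : ∀ {n} → Fin n → PR n
  comp : ∀ {m n} → PR m → Vec (PR n) m → PR n
  prec : ∀ {n} → PR n → PR (suc (suc n)) → PR (suc n)
  mu   : ∀ {n} → PR (suc n) → PR n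

mutual
  data Eval : ∀ {n} → PR n → Vec ℕ n → ℕ → Set where
    ev-zer  : ∀ {n} {xs : Vec ℕ n} → Eval zer xs 0
    ev-succ : ∀ {x} → Eval succ (x ∷ []) (suc x)
    ev-proj : ∀ {n} {i : Fin n} {xs : Vec ℕ n} → Eval (proj i) xs (lookup xs i)
    ev-comp : ∀ {m n} {f : PR m} {gs : Vec (PR n) m} {xs : Vec ℕ n} {ys : Vec ℕ m} {y} →
              EvalAll gs xs ys → Eval f ys y → Eval (comp f gs) xs y
    ev-prec-z : ∀ {n} {g : PR n} {h : PR (suc (suc n))} {xs : Vec ℕ n} {y} →
                Eval g xs y → Eval (prec g h) (0 ∷ xs) y
    ev-prec-s : ∀ {n} {g : PR n} {h : PR (suc (suc n))} {xs : Vec ℕ n} {k r y} →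
                Eval (prec g h) (k ∷ xs) r → Eval h (k ∷ r ∷ xs) y →
                Eval (prec g h) (suc k ∷ xs) y
    ev-mu : ∀ {n} {f : PR (suc n)} {xs : Vec ℕ n} {y} →
            Eval f (y ∷ xs) 0 →
            (∀ z → z < y → ∃ λ k → Eval f (z ∷ xs) (suc k)) →
            Eval (mu f) xs y

  data EvalAll : ∀ {m n} → Vec (PR n) m → Vec ℕ n → Vec ℕ m → Set where
    []  : ∀ {n} {xs : Vec ℕ n} → EvalAll [] xs []
    _∷_ : ∀ {m n} {g : PR n} {gs : Vec (PR n) m} {xs : Vec ℕ n} {y} {ys : Vec ℕ m} →
          Eval g xs y → EvalAll gs xs ys → EvalAll (g ∷ gs) xs (y ∷ ys)

Computable : (ℕ → ℕ) → Set
Computable f = ∃ λ (e : PR 1) → ∀ x → Eval e (x ∷ []) (f x)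

IsCE₂ : (ℕ → ℕ → Set) → Set
IsCE₂ R = ∃ λ (e : PR 2) → ∀ x y → R x y ⇔ (∃ λ z → Eval e (x ∷ y ∷ []) z)

record IsCeer (R : ℕ → ℕ → Set) : Set where
  field
    isEquivalence : IsEquivalence R
    isCE          : IsCE₂ R

_≤c_ : (ℕ → ℕ → Set) → (ℕ → ℕ → Set) → Set
R ≤c S = ∃ λ (f : ℕ → ℕ) → Computable f × (∀ x y → R x y ⇔ S (f x) (f y))

_≡c_ : (ℕ → ℕ → Set) → (ℕ → ℕ → Set) → Set
R ≡c S = (R ≤c S) × (S ≤c R)

Idω : ℕ → ℕ → Set
Idω = _≡_

_⊕_ : (ℕ → ℕ → Set) → (ℕ → ℕ → Set) → (ℕ → ℕ → Set)
(U ⊕ V) m n =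
  (∃ λ x → ∃ λ y → m ≡ 2 * x × n ≡ 2 * y × U x y) ⊎
  (∃ λ x → ∃ λ y → m ≡ 2 * x + 1 × n ≡ 2 * y + 1 × V x y)

-- Two-generator semigroups: quotients of the free semigroup {a,b}⁺

-- Free semigroup on X = {a, b}: nonempty words; a = true, b = false.
Word : Set
Word = List⁺ Bool

-- Fixed computable coding of X⁺ onto ω (bijective base-2 numeration, shifted):
-- the word c₁…cₙ (digit 1 for a, 2 for b) ↦ (Σ dᵢ 2^(n-i)) - 1.
digit : Bool → ℕ
digit true  = 1
digit false = 2

encodeAcc : ℕ → List Bool → ℕ
encodeAcc acc []       = acc
encodeAcc acc (c ∷ cs) = encodeAcc (2 * acc + digit c) cs

code : Word → ℕ
code (c ∷ cs) = encodeAcc (digit c) cs ∸ 1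

record IsCongruence (_≈_ : Word → Word → Set) : Set where
  field
    isEquivalence : IsEquivalence _≈_
    compatible    : ∀ {u u′ v v′} → u ≈ u′ → v ≈ v′ → (u ⁺++⁺ v) ≈ (u′ ⁺++⁺ v′)

WordProblem : (Word → Word → Set) → (ℕ → ℕ → Set)
WordProblem _≈_ m n = ∃ λ u → ∃ λ v → code u ≡ m × code v ≡ n × u ≈ v

record TwoGenCESemigroup : Set₁ where
  field
    _≈_          : Word → Word → Set
    isCongruence : IsCongruence _≈_
    isCE         : IsCE₂ (WordProblem _≈_)

-- Let h reduce R ⊕ Idω to R. In the semigroup S the words aⁿ, aⁿ b, b aⁿ and b (the factors of
-- the words b aⁿ b with at most one b) are equal only to themselves, b aᵐ b = b aⁿ b holds iff
-- m R n, and all other words are equal to one zero. This is a congruence because a product with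
-- a factor of the last two sorts is zero. Sending a word to 2 (code w + 1) + 1, to 2 n, or to 1
-- according to its sort turns =_S into the preimage of R ⊕ Idω; the map is computable because
-- its ingredients are primitive recursive in the bijective base-2 digits of code w. Hence
-- =_S ≤c R ⊕ Idω ≤c R, while n ↦ b aⁿ b reduces R to =_S.

module Submission where

open import Defs
open import Data.Bool using (Bool; true; false)
open import Data.Empty using (⊥-elim)
open import Data.Fin using (Fin)
open import Data.Fin.Patterns using (0F; 1F; 2F)
open import Data.List
  using (List; []; _∷_; _++_; _ʳ++_; _∷ʳ_; foldl; map; take; drop; length; reverse; replicate)
open import Data.List.NonEmpty using (List⁺; _∷_; _⁺++⁺_; toList)
open import Data.List.Properties
  using (foldl-++; map-++; take-all; drop-drop; reverse-++; unfold-reverse; reverse-involutive)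
open import Data.Nat using (ℕ; zero; suc; _+_; _*_; _≤_; z≤n; s≤s; pred; ≢-nonZero)
open import Data.Nat.ListAction using (sum)
open import Data.Nat.ListAction.Properties using (sum-++)
open import Data.Nat.Properties
  using (<-cmp; +-identityʳ; +-comm; +-assoc; +-suc; *-suc; *-cancelˡ-≡; suc-injective; suc-pred;
         even≢odd; ≤-trans; m≤m+n; n≤1+n)
open import Data.Product using (Σ; ∃; ∃₂; _×_; _,_; proj₂)
open import Data.Sum using (_⊎_; inj₁; inj₂; map₂)
open import Data.Vec using (Vec; []; _∷_; lookup; head; tail)
open import Function.Base using (_∘_; _on_)
open import Function.Bundles using (_⇔_; mk⇔)
import Function.Properties.Equivalence as ⇔
open import Relation.Binary using (tri<; tri≈; tri>)
import Relation.Binary.Construct.On as On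
open import Relation.Binary.PropositionalEquality
open import Relation.Binary.Structures using (IsEquivalence)
open import Relation.Nullary using (¬_)
open ≡-Reasoning

mutual
  eval-deterministic : ∀ {n} {f : PR n} {xs y y′} → Eval f xs y → Eval f xs y′ → y ≡ y′
  eval-deterministic ev-zer ev-zer = refl
  eval-deterministic ev-succ ev-succ = refl
  eval-deterministic ev-proj ev-proj = refl
  eval-deterministic (ev-comp gs f) (ev-comp gs′ f′)
    with refl ← evalAll-deterministic gs gs′ = eval-deterministic f f′
  eval-deterministic (ev-prec-z g) (ev-prec-z g′) = eval-deterministic g g′
  eval-deterministic (ev-prec-s r h) (ev-prec-s r′ h′)
    with refl ← eval-deterministic r r′ = eval-deterministic h h′
  eval-deterministic {y = y} {y′} (ev-mu f0 below) (ev-mu f0′ below′) with <-cmp y y′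
  ... | tri≈ _ y≡y′ _ = y≡y′
  ... | tri< y<y′ _ _ with () ← eval-deterministic f0 (proj₂ (below′ y y<y′))
  ... | tri> _ _ y′<y with () ← eval-deterministic (proj₂ (below y′ y′<y)) f0′

  evalAll-deterministic : ∀ {m n} {gs : Vec (PR n) m} {xs ys ys′} →
                          EvalAll gs xs ys → EvalAll gs xs ys′ → ys ≡ ys′
  evalAll-deterministic [] [] = refl
  evalAll-deterministic (g ∷ gs) (g′ ∷ gs′) =
    cong₂ _∷_ (eval-deterministic g g′) (evalAll-deterministic gs gs′)

Computes : ∀ n → (Vec ℕ n → ℕ) → Set
Computes n f = Σ (PR n) λ e → ∀ xs → Eval e xs (f xs)

data ComputesAll {n : ℕ} : ∀ m → (Vec ℕ n → Vec ℕ m) → Set where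
  []  : ComputesAll 0 (λ _ → [])
  _∷_ : ∀ {m f g} → Computes n f → ComputesAll m g → ComputesAll (suc m) (λ xs → f xs ∷ g xs)

codes : ∀ {n m g} → ComputesAll {n} m g → Vec (PR n) m
codes []            = []
codes ((e , _) ∷ c) = e ∷ codes c

evalAll-codes : ∀ {n m g} (c : ComputesAll {n} m g) xs → EvalAll (codes c) xs (g xs)
evalAll-codes []            xs = []
evalAll-codes ((_ , e) ∷ c) xs = e xs ∷ evalAll-codes c xs

computes-ext : ∀ {n f g} → Computes n f → (∀ xs → f xs ≡ g xs) → Computes n g
computes-ext (e , ev) f≗g = e , λ xs → subst (Eval e xs) (f≗g xs) (ev xs)

computes-proj : ∀ {n} (i : Fin n) → Computes n (λ xs → lookup xs i)
computes-proj i = proj i , λ _ → ev-proj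

computes-∘ : ∀ {m n f g} → Computes m f → ComputesAll {n} m g → Computes n (λ xs → f (g xs))
computes-∘ (e , ev) c = comp e (codes c) , λ xs → ev-comp (evalAll-codes c xs) (ev _)

computes-suc : ∀ {n f} → Computes n f → Computes n (λ xs → suc (f xs))
computes-suc c = computes-∘ {f = λ xs → suc (head xs)} (succ , λ { (_ ∷ []) → ev-succ }) (c ∷ [])

computes-const : ∀ {n} k → Computes n (λ _ → k)
computes-const zero    = zer , λ _ → ev-zer
computes-const (suc k) = computes-suc (computes-const k)

computes-rec : ∀ {n g h} (f : ℕ → Vec ℕ n → ℕ) → Computes n g → Computes (suc (suc n)) h →
               (∀ xs → f 0 xs ≡ g xs) → (∀ k xs → f (suc k) xs ≡ h (k ∷ f k xs ∷ xs)) →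
               Computes (suc n) (λ xs → f (head xs) (tail xs))
computes-rec {n} f (eg , evg) (eh , evh) f-zero f-suc = prec eg eh , λ { (k ∷ xs) → eval-prec k xs }
  where
  eval-prec : ∀ k (xs : Vec ℕ n) → Eval (prec eg eh) (k ∷ xs) (f k xs)
  eval-prec zero    xs = ev-prec-z (subst (Eval eg xs) (sym (f-zero xs)) (evg xs))
  eval-prec (suc k) xs = ev-prec-s (eval-prec k xs) (subst (Eval eh _) (sym (f-suc k xs)) (evh _))

-- Records rather than Σ-types, so that f can be inferred from the type.
record Computable₁ (f : ℕ → ℕ) : Set where
  constructor computable₁
  field computes₁ : Computes 1 (λ xs → f (lookup xs 0F))

record Computable₂ (f : ℕ → ℕ → ℕ) : Set where
  constructor computable₂
  field computes₂ : Computes 2 (λ xs → f (lookup xs 0F) (lookup xs 1F))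

record Computable₃ (f : ℕ → ℕ → ℕ → ℕ) : Set where
  constructor computable₃
  field computes₃ : Computes 3 (λ xs → f (lookup xs 0F) (lookup xs 1F) (lookup xs 2F))

computes-∘₁ : ∀ {n f a} → Computable₁ f → Computes n a → Computes n (λ xs → f (a xs))
computes-∘₁ {f = f} (computable₁ c) ca = computes-∘ {f = λ xs → f (lookup xs 0F)} c (ca ∷ [])

computes-∘₂ : ∀ {n f a b} → Computable₂ f → Computes n a → Computes n b →
              Computes n (λ xs → f (a xs) (b xs))
computes-∘₂ {f = f} (computable₂ c) ca cb =
  computes-∘ {f = λ xs → f (lookup xs 0F) (lookup xs 1F)} c (ca ∷ cb ∷ [])

computes-∘₃ : ∀ {n f a b d} → Computable₃ f → Computes n a → Computes n b → Computes n d →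
              Computes n (λ xs → f (a xs) (b xs) (d xs))
computes-∘₃ {f = f} (computable₃ c) ca cb cd =
  computes-∘ {f = λ xs → f (lookup xs 0F) (lookup xs 1F) (lookup xs 2F)} c (ca ∷ cb ∷ cd ∷ [])

computable₁-rec : (f : ℕ → ℕ) (h : ℕ → ℕ → ℕ) → Computable₂ h →
                  (∀ k → f (suc k) ≡ h k (f k)) → Computable₁ f
computable₁-rec f h (computable₂ ch) f-suc = computable₁ (computes-ext
  (computes-rec (λ k _ → f k) (computes-const (f 0)) ch (λ _ → refl) (λ k _ → f-suc k))
  λ { (_ ∷ []) → refl })

computable₂-rec : (f : ℕ → ℕ → ℕ) (g : ℕ → ℕ) (h : ℕ → ℕ → ℕ → ℕ) →
                  Computable₁ g → Computable₃ h →
                  (∀ N → f 0 N ≡ g N) → (∀ k N → f (suc k) N ≡ h k (f k N) N) → Computable₂ f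
computable₂-rec f g h (computable₁ cg) (computable₃ ch) f-zero f-suc = computable₂ (computes-ext
  (computes-rec (λ k xs → f k (head xs)) cg ch
     (λ { (N ∷ []) → f-zero N }) (λ { k (N ∷ []) → f-suc k N }))
  λ { (_ ∷ _ ∷ []) → refl })

computable⇒computable₁ : ∀ {f} → Computable f → Computable₁ f
computable⇒computable₁ (e , ev) = computable₁ (e , λ { (x ∷ []) → ev x })

computable₁⇒computable : ∀ {f} → Computable₁ f → Computable f
computable₁⇒computable (computable₁ (e , ev)) = e , λ x → ev (x ∷ [])

computable-∘ : ∀ {f g} → Computable f → Computable g → Computable (g ∘ f)
computable-∘ cf cg = computable₁⇒computable (computable₁
  (computes-∘₁ (computable⇒computable₁ cg)
    (computes-∘₁ (computable⇒computable₁ cf) (computes-proj 0F))))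

≤c-trans : ∀ {P Q T} → P ≤c Q → Q ≤c T → P ≤c T
≤c-trans (f , cf , P⇔Qf) (g , cg , Q⇔Tg) =
  g ∘ f , computable-∘ cf cg , λ x y → ⇔.trans (P⇔Qf x y) (Q⇔Tg (f x) (f y))

IsCE₂-≤c : ∀ {P Q} → P ≤c Q → IsCE₂ Q → IsCE₂ P
IsCE₂-≤c {P} {Q} (f , cf , P⇔Qf) (e , Q⇔halts) =
  comp e (codes args) ,
  λ x y → ⇔.trans (P⇔Qf x y) (⇔.trans (Q⇔halts (f x) (f y)) (mk⇔ halts-comp (comp-halts x y)))
  where
  args : ComputesAll 2 (λ xs → f (lookup xs 0F) ∷ f (lookup xs 1F) ∷ [])
  args = computes-∘₁ (computable⇒computable₁ cf) (computes-proj 0F)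
       ∷ computes-∘₁ (computable⇒computable₁ cf) (computes-proj 1F) ∷ []

  halts-comp : ∀ {x y} → ∃ (Eval e (f x ∷ f y ∷ [])) → ∃ (Eval (comp e (codes args)) (x ∷ y ∷ []))
  halts-comp (z , ev) = z , ev-comp (evalAll-codes args _) ev

  comp-halts : ∀ x y → ∃ (Eval (comp e (codes args)) (x ∷ y ∷ [])) → ∃ (Eval e (f x ∷ f y ∷ []))
  comp-halts x y (z , ev-comp evs ev)
    with refl ← evalAll-deterministic evs (evalAll-codes args (x ∷ y ∷ [])) = z , ev

2*+1≡suc : ∀ n → 2 * n + 1 ≡ suc (2 * n)
2*+1≡suc n = +-comm (2 * n) 1

2*+1-injective : ∀ m n → 2 * m + 1 ≡ 2 * n + 1 → m ≡ n
2*+1-injective m n e = *-cancelˡ-≡ m n 2 (suc-injective (trans (sym (2*+1≡suc m)) (trans e (2*+1≡suc n))))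

even-or-odd : ∀ n → (∃ λ k → n ≡ 2 * k) ⊎ (∃ λ k → n ≡ 2 * k + 1)
even-or-odd zero = inj₁ (0 , refl)
even-or-odd (suc n) with even-or-odd n
... | inj₁ (k , n≡2k)   = inj₂ (k , trans (cong suc n≡2k) (sym (2*+1≡suc k)))
... | inj₂ (k , n≡2k+1) =
  inj₁ (suc k , trans (cong suc n≡2k+1) (trans (cong suc (2*+1≡suc k)) (sym (*-suc 2 k))))

module _ {U V : ℕ → ℕ → Set} where

  ⊕-even : ∀ {x y} → (U ⊕ V) (2 * x) (2 * y) → U x y
  ⊕-even {x} {y} (inj₁ (x′ , y′ , ex , ey , u))
    with refl ← *-cancelˡ-≡ x x′ 2 ex | refl ← *-cancelˡ-≡ y y′ 2 ey = u
  ⊕-even {x} (inj₂ (x′ , _ , ex , _ , _)) = ⊥-elim (even≢odd x x′ (trans ex (2*+1≡suc x′)))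

  ⊕-odd : ∀ {x y} → (U ⊕ V) (2 * x + 1) (2 * y + 1) → V x y
  ⊕-odd {x} (inj₁ (x′ , _ , ex , _ , _)) = ⊥-elim (even≢odd x′ x (trans (sym ex) (2*+1≡suc x)))
  ⊕-odd {x} {y} (inj₂ (x′ , y′ , ex , ey , v))
    with refl ← 2*+1-injective x x′ ex | refl ← 2*+1-injective y y′ ey = v

  ⊕-even-odd : ∀ {x y} → ¬ (U ⊕ V) (2 * x) (2 * y + 1)
  ⊕-even-odd {x} {y} (inj₁ (_ , y′ , _ , ey , _)) = ⊥-elim (even≢odd y′ y (trans (sym ey) (2*+1≡suc y)))
  ⊕-even-odd {x} {y} (inj₂ (x′ , _ , ex , _ , _)) = ⊥-elim (even≢odd x x′ (trans ex (2*+1≡suc x′)))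

  ⊕-odd-even : ∀ {x y} → ¬ (U ⊕ V) (2 * x + 1) (2 * y)
  ⊕-odd-even {x} {y} (inj₁ (x′ , _ , ex , _ , _)) = ⊥-elim (even≢odd x′ x (trans (sym ex) (2*+1≡suc x)))
  ⊕-odd-even {x} {y} (inj₂ (_ , y′ , _ , ey , _)) = ⊥-elim (even≢odd y y′ (trans ey (2*+1≡suc y′)))

  ⊕-isEquivalence : IsEquivalence U → IsEquivalence V → IsEquivalence (U ⊕ V)
  ⊕-isEquivalence eqU eqV = record { refl = ⊕-refl ; sym = ⊕-sym ; trans = ⊕-trans }
    where
    module U = IsEquivalence eqU
    module V = IsEquivalence eqV

    ⊕-refl : ∀ {x} → (U ⊕ V) x x
    ⊕-refl {x} with even-or-odd x
    ... | inj₁ (k , e) = inj₁ (k , k , e , e , U.refl)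
    ... | inj₂ (k , e) = inj₂ (k , k , e , e , V.refl)

    ⊕-sym : ∀ {x y} → (U ⊕ V) x y → (U ⊕ V) y x
    ⊕-sym (inj₁ (a , b , ea , eb , u)) = inj₁ (b , a , eb , ea , U.sym u)
    ⊕-sym (inj₂ (a , b , ea , eb , v)) = inj₂ (b , a , eb , ea , V.sym v)

    ⊕-trans : ∀ {x y z} → (U ⊕ V) x y → (U ⊕ V) y z → (U ⊕ V) x z
    ⊕-trans (inj₁ (a , b , ea , eb , u)) (inj₁ (b′ , c , eb′ , ec , u′))
      with refl ← *-cancelˡ-≡ b b′ 2 (trans (sym eb) eb′) = inj₁ (a , c , ea , ec , U.trans u u′)
    ⊕-trans (inj₂ (a , b , ea , eb , v)) (inj₂ (b′ , c , eb′ , ec , v′))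
      with refl ← 2*+1-injective b b′ (trans (sym eb) eb′) = inj₂ (a , c , ea , ec , V.trans v v′)
    ⊕-trans (inj₁ (_ , b , _ , eb , _)) (inj₂ (b′ , _ , eb′ , _ , _)) =
      ⊥-elim (even≢odd b b′ (trans (sym eb) (trans eb′ (2*+1≡suc b′))))
    ⊕-trans (inj₂ (_ , b , _ , eb , _)) (inj₁ (b′ , _ , eb′ , _ , _)) =
      ⊥-elim (even≢odd b′ b (trans (sym eb′) (trans eb (2*+1≡suc b))))

ifNonzero : ℕ → ℕ → ℕ → ℕ
ifNonzero zero    x y = y
ifNonzero (suc _) x y = x

computable-ifNonzero : Computable₃ ifNonzero
computable-ifNonzero = computable₃ (computes-ext
  (computes-rec (λ c xs → ifNonzero c (lookup xs 0F) (lookup xs 1F)) (computes-proj 1F) (computes-proj 2F)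
     (λ _ → refl) (λ _ _ → refl))
  λ { (_ ∷ _ ∷ _ ∷ []) → refl })

computable-id : Computable₁ (λ x → x)
computable-id = computable₁ (computes-proj 0F)

computable-+ : Computable₂ _+_
computable-+ = computable₂-rec _+_ (λ y → y) (λ _ r _ → suc r)
  computable-id (computable₃ (computes-suc (computes-proj 1F)))
  (λ _ → refl) (λ _ _ → refl)

computable-2* : Computable₁ (2 *_)
computable-2* = computable₁ (computes-ext (computes-∘₂ computable-+ (computes-proj 0F) (computes-proj 0F))
  λ { (x ∷ []) → cong (x +_) (sym (+-identityʳ x)) })

computable-pred : Computable₁ pred
computable-pred = computable₁-rec pred (λ k _ → k) (computable₂ (computes-proj 0F)) (λ _ → refl)

isOdd : ℕ → ℕ
isOdd zero    = 0
isOdd (suc k) = ifNonzero (isOdd k) 0 1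

computable-isOdd : Computable₁ isOdd
computable-isOdd = computable₁-rec isOdd (λ _ r → ifNonzero r 0 1)
  (computable₂ (computes-∘₃ computable-ifNonzero (computes-proj 1F) (computes-const 0) (computes-const 1)))
  (λ _ → refl)

half : ℕ → ℕ
half zero    = 0
half (suc k) = half k + isOdd k

computable-half : Computable₁ half
computable-half = computable₁-rec half (λ k r → r + isOdd k)
  (computable₂ (computes-∘₂ computable-+ (computes-proj 1F)
                             (computes-∘₁ computable-isOdd (computes-proj 0F))))
  (λ _ → refl)

isOdd-even : ∀ e → isOdd (e + e) ≡ 0
isOdd-even zero    = refl
isOdd-even (suc e) rewrite +-suc e e | isOdd-even e = refl

isOdd-odd : ∀ e → isOdd (suc (e + e)) ≡ 1
isOdd-odd e rewrite isOdd-even e = refl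

half-even : ∀ e → half (e + e) ≡ e
half-odd  : ∀ e → half (suc (e + e)) ≡ e
half-even zero    = refl
half-even (suc e) rewrite +-suc e e | half-odd e | isOdd-odd e = +-comm e 1
half-odd e rewrite half-even e | isOdd-even e = +-identityʳ e

isA : Bool → ℕ
isA true  = 1
isA false = 0

isB : Bool → ℕ
isB true  = 0
isB false = 1

isA-injective : ∀ {c d} → isA c ≡ isA d → c ≡ d
isA-injective {true}  {true}  _ = refl
isA-injective {false} {false} _ = refl

-- Digits are listed least significant first, with a = 1 and b = 2, so that the digit string
-- of a word is its reversal (see suc-code).
encodeLE : List Bool → ℕ
encodeLE []      = 0
encodeLE (c ∷ r) = 2 * encodeLE r + digit c

2*≡+ : ∀ e → 2 * e ≡ e + e
2*≡+ e = cong (e +_) (+-identityʳ e)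

encodeLE-true : ∀ r → encodeLE (true ∷ r) ≡ suc (encodeLE r + encodeLE r)
encodeLE-true r = trans (+-comm (2 * encodeLE r) 1) (cong suc (2*≡+ (encodeLE r)))

encodeLE-false : ∀ r → encodeLE (false ∷ r) ≡ suc (suc (encodeLE r + encodeLE r))
encodeLE-false r = trans (+-comm (2 * encodeLE r) 2) (cong (2 +_) (2*≡+ (encodeLE r)))

encodeLE-∷≢0 : ∀ c r → encodeLE (c ∷ r) ≢ 0
encodeLE-∷≢0 true  r e with () ← trans (sym (encodeLE-true r)) e
encodeLE-∷≢0 false r e with () ← trans (sym (encodeLE-false r)) e

dropLow : ℕ → ℕ
dropLow N = half (pred N)

lowIsB : ℕ → ℕ
lowIsB zero    = 0
lowIsB (suc k) = isOdd k

computable-dropLow : Computable₁ dropLow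
computable-dropLow =
  computable₁ (computes-∘₁ computable-half (computes-∘₁ computable-pred (computes-proj 0F)))

computable-lowIsB : Computable₁ lowIsB
computable-lowIsB = computable₁-rec lowIsB (λ k _ → isOdd k)
  (computable₂ (computes-∘₁ computable-isOdd (computes-proj 0F))) (λ _ → refl)

dropLow-encodeLE : ∀ c r → dropLow (encodeLE (c ∷ r)) ≡ encodeLE r
dropLow-encodeLE true  r rewrite encodeLE-true r  = half-even (encodeLE r)
dropLow-encodeLE false r rewrite encodeLE-false r = half-odd (encodeLE r)

isOdd-encodeLE : ∀ c r → isOdd (encodeLE (c ∷ r)) ≡ isA c
isOdd-encodeLE true  r rewrite encodeLE-true r                            = isOdd-odd (encodeLE r)
isOdd-encodeLE false r rewrite encodeLE-false r | isOdd-odd (encodeLE r) = refl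

lowIsB-encodeLE : ∀ c r → lowIsB (encodeLE (c ∷ r)) ≡ isB c
lowIsB-encodeLE true  r rewrite encodeLE-true r  = isOdd-even (encodeLE r)
lowIsB-encodeLE false r rewrite encodeLE-false r = isOdd-odd (encodeLE r)

encodeLE-injective : ∀ p q → encodeLE p ≡ encodeLE q → p ≡ q
encodeLE-injective []      []      _ = refl
encodeLE-injective []      (d ∷ s) e = ⊥-elim (encodeLE-∷≢0 d s (sym e))
encodeLE-injective (c ∷ r) []      e = ⊥-elim (encodeLE-∷≢0 c r e)
encodeLE-injective (c ∷ r) (d ∷ s) e = cong₂ _∷_
  (isA-injective (trans (sym (isOdd-encodeLE c r)) (trans (cong isOdd e) (isOdd-encodeLE d s))))
  (encodeLE-injective r s (trans (sym (dropLow-encodeLE c r)) (trans (cong dropLow e) (dropLow-encodeLE d s))))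

length≤encodeLE : ∀ p → length p ≤ encodeLE p
length≤encodeLE []      = z≤n
length≤encodeLE (true ∷ r) rewrite encodeLE-true r =
  s≤s (≤-trans (length≤encodeLE r) (m≤m+n _ _))
length≤encodeLE (false ∷ r) rewrite encodeLE-false r =
  s≤s (≤-trans (length≤encodeLE r) (≤-trans (m≤m+n _ _) (n≤1+n _)))

increment : List Bool → List⁺ Bool
increment []          = true ∷ []
increment (true ∷ r)  = false ∷ r
increment (false ∷ r) = true ∷ toList (increment r)

encodeLE-increment : ∀ p → encodeLE (toList (increment p)) ≡ suc (encodeLE p)
encodeLE-increment []          = refl
encodeLE-increment (true ∷ r)  = +-suc (2 * encodeLE r) 1
encodeLE-increment (false ∷ r) = begin
  2 * encodeLE (toList (increment r)) + 1 ≡⟨ cong (λ n → 2 * n + 1) (encodeLE-increment r) ⟩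
  2 * suc (encodeLE r) + 1                ≡⟨ cong (_+ 1) (*-suc 2 (encodeLE r)) ⟩
  suc (suc (2 * encodeLE r + 1))          ≡⟨ cong suc (+-suc (2 * encodeLE r) 1) ⟨
  suc (2 * encodeLE r + 2)                ∎

decodeLE : ℕ → List Bool
decodeLE zero    = []
decodeLE (suc n) = toList (increment (decodeLE n))

encodeLE-decodeLE : ∀ n → encodeLE (decodeLE n) ≡ n
encodeLE-decodeLE zero    = refl
encodeLE-decodeLE (suc n) = trans (encodeLE-increment (decodeLE n)) (cong suc (encodeLE-decodeLE n))

dropLows : ℕ → ℕ → ℕ
dropLows zero    N = N
dropLows (suc k) N = dropLow (dropLows k N)

computable-dropLows : Computable₂ dropLows
computable-dropLows = computable₂-rec dropLows (λ N → N) (λ _ r _ → dropLow r) computable-id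
  (computable₃ (computes-∘₁ computable-dropLow (computes-proj 1F))) (λ _ → refl) (λ _ _ → refl)

dropLow-encodeLE-drop : ∀ p → dropLow (encodeLE p) ≡ encodeLE (drop 1 p)
dropLow-encodeLE-drop []      = refl
dropLow-encodeLE-drop (c ∷ r) = dropLow-encodeLE c r

dropLows-encodeLE : ∀ k p → dropLows k (encodeLE p) ≡ encodeLE (drop k p)
dropLows-encodeLE zero    p = refl
dropLows-encodeLE (suc k) p = begin
  dropLow (dropLows k (encodeLE p)) ≡⟨ cong dropLow (dropLows-encodeLE k p) ⟩
  dropLow (encodeLE (drop k p))     ≡⟨ dropLow-encodeLE-drop (drop k p) ⟩
  encodeLE (drop 1 (drop k p))      ≡⟨ cong encodeLE (drop-drop k 1 p) ⟩
  encodeLE (drop (k + 1) p)         ≡⟨ cong (λ i → encodeLE (drop i p)) (+-comm k 1) ⟩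
  encodeLE (drop (suc k) p)         ∎

foldDigits : (ℕ → ℕ → ℕ) → ℕ → ℕ → ℕ → ℕ
foldDigits step x₀ zero    N = x₀
foldDigits step x₀ (suc k) N = step (foldDigits step x₀ k N) (dropLows k N)

computable-foldDigits : ∀ {step} x₀ → Computable₂ step → Computable₂ (foldDigits step x₀)
computable-foldDigits {step} x₀ computable-step = computable₂-rec (foldDigits step x₀) (λ _ → x₀)
  (λ k r N → step r (dropLows k N)) (computable₁ (computes-const x₀))
  (computable₃ (computes-∘₂ computable-step (computes-proj 1F)
                 (computes-∘₂ computable-dropLows (computes-proj 0F) (computes-proj 2F))))
  (λ _ → refl) (λ _ _ → refl)

take-suc-++ : ∀ {A : Set} k (p : List A) → take (suc k) p ≡ take k p ++ take 1 (drop k p)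
take-suc-++ zero    []      = refl
take-suc-++ zero    (x ∷ p) = refl
take-suc-++ (suc k) []      = refl
take-suc-++ (suc k) (x ∷ p) = cong (x ∷_) (take-suc-++ k p)

module _ (step : ℕ → ℕ → ℕ) (g : ℕ → Bool → ℕ)
         (step-0 : ∀ x → step x 0 ≡ x) (step-digit : ∀ x c r → step x (encodeLE (c ∷ r)) ≡ g x c) where

  step-encodeLE : ∀ x q → step x (encodeLE q) ≡ foldl g x (take 1 q)
  step-encodeLE x []      = step-0 x
  step-encodeLE x (c ∷ r) = step-digit x c r

  foldDigits-take : ∀ x₀ k p → foldDigits step x₀ k (encodeLE p) ≡ foldl g x₀ (take k p)
  foldDigits-take x₀ zero    p = refl
  foldDigits-take x₀ (suc k) p = begin
    step (foldDigits step x₀ k (encodeLE p)) (dropLows k (encodeLE p))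
      ≡⟨ cong₂ step (foldDigits-take x₀ k p) (dropLows-encodeLE k p) ⟩
    step (foldl g x₀ (take k p)) (encodeLE (drop k p))
      ≡⟨ step-encodeLE _ (drop k p) ⟩
    foldl g (foldl g x₀ (take k p)) (take 1 (drop k p))
      ≡⟨ foldl-++ g x₀ (take k p) _ ⟨
    foldl g x₀ (take k p ++ take 1 (drop k p))
      ≡⟨ cong (foldl g x₀) (take-suc-++ k p) ⟨
    foldl g x₀ (take (suc k) p)
      ∎

  foldDigits-encodeLE : ∀ x₀ p → foldDigits step x₀ (encodeLE p) (encodeLE p) ≡ foldl g x₀ p
  foldDigits-encodeLE x₀ p =
    trans (foldDigits-take x₀ (encodeLE p) p) (cong (foldl g x₀) (take-all (encodeLE p) p (length≤encodeLE p)))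

data Kind : Set where
  inR absorbing isolated : Kind

-- The arguments are the number of b's and whether the first and the last digit is b; as digits
-- are read from the end of a word, these are its last and its first letter.
kind : ℕ → ℕ → ℕ → Kind
kind zero                h       l       = isolated
kind (suc zero)          zero    zero    = absorbing
kind (suc zero)          zero    (suc _) = isolated
kind (suc zero)          (suc _) l       = isolated
kind (suc (suc zero))    (suc _) (suc _) = inR
kind (suc (suc zero))    zero    l       = absorbing
kind (suc (suc zero))    (suc _) zero    = absorbing
kind (suc (suc (suc _))) h       l       = absorbing

-- The value 1 of the zero is also 2 · 0 + 1, the value of the empty digit string; nonempty
-- strings have nonzero encodings, which is why kindValue-⊕Idω assumes N ≢ 0.
kindValue : Kind → ℕ → ℕ → ℕ
kindValue inR       na N = 2 * na
kindValue absorbing na N = 1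
kindValue isolated  na N = 2 * N + 1

classValue : ℕ → ℕ → ℕ → ℕ → ℕ → ℕ
classValue nb na h l N = kindValue (kind nb h l) na N

classValue-ifNonzero : ∀ nb na h l N →
  ifNonzero nb (ifNonzero (pred nb) (ifNonzero (pred (pred nb)) 1 (ifNonzero h (ifNonzero l (2 * na) 1) 1))
                                    (ifNonzero (h + l) (2 * N + 1) 1))
               (2 * N + 1)
  ≡ classValue nb na h l N
classValue-ifNonzero zero                na h       l       N = refl
classValue-ifNonzero (suc zero)          na zero    zero    N = refl
classValue-ifNonzero (suc zero)          na zero    (suc l) N = refl
classValue-ifNonzero (suc zero)          na (suc h) l       N = refl
classValue-ifNonzero (suc (suc zero))    na (suc h) (suc l) N = refl
classValue-ifNonzero (suc (suc zero))    na zero    l       N = refl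
classValue-ifNonzero (suc (suc zero))    na (suc h) zero    N = refl
classValue-ifNonzero (suc (suc (suc _))) na h       l       N = refl

computes-classValue : ∀ {n nb na h l N} → Computes n nb → Computes n na → Computes n h → Computes n l →
                      Computes n N → Computes n (λ xs → classValue (nb xs) (na xs) (h xs) (l xs) (N xs))
computes-classValue {n} {nb} {na} {h} {l} {N} cnb cna ch cl cN = computes-ext
  (if cnb (if (pred′ cnb) (if (pred′ (pred′ cnb)) one (if ch (if cl (computes-∘₁ computable-2* cna) one) one))
                          (if (computes-∘₂ computable-+ ch cl) odd one))
          odd)
  (λ xs → classValue-ifNonzero (nb xs) (na xs) (h xs) (l xs) (N xs))
  where
  if : ∀ {a b c} → Computes n a → Computes n b → Computes n c →
       Computes n (λ xs → ifNonzero (a xs) (b xs) (c xs))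
  if = computes-∘₃ computable-ifNonzero
  pred′ : ∀ {a} → Computes n a → Computes n (λ xs → pred (a xs))
  pred′ = computes-∘₁ computable-pred
  one : Computes n (λ _ → 1)
  one = computes-const 1
  odd : Computes n (λ xs → 2 * N xs + 1)
  odd = computes-∘₂ computable-+ (computes-∘₁ computable-2* cN) one

countA countB : List Bool → ℕ
countA p = sum (map isA p)
countB p = sum (map isB p)

firstIsB lastIsB : List Bool → ℕ
firstIsB []      = 0
firstIsB (c ∷ _) = isB c
lastIsB p = foldl (λ _ c → isB c) 0 p

kindOf : List Bool → Kind
kindOf p = kind (countB p) (firstIsB p) (lastIsB p)

classOf : List Bool → ℕ
classOf p = classValue (countB p) (countA p) (firstIsB p) (lastIsB p) (encodeLE p)

countDigits : (ℕ → ℕ) → ℕ → ℕ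
countDigits low N = foldDigits (λ x M → x + low M) 0 N N

lastDigitIsB : ℕ → ℕ
lastDigitIsB N = foldDigits (λ x M → ifNonzero M (lowIsB M) x) 0 N N

classOfEncoding : ℕ → ℕ
classOfEncoding N = classValue (countDigits lowIsB N) (countDigits isOdd N) (lowIsB N) (lastDigitIsB N) N

computable-classOfEncoding : Computable₁ classOfEncoding
computable-classOfEncoding = computable₁ (computes-classValue
  (countDigits′ computable-lowIsB) (countDigits′ computable-isOdd) (computes-∘₁ computable-lowIsB N)
  (computes-∘₂ (computable-foldDigits 0 (computable₂ (computes-∘₃ computable-ifNonzero M
                  (computes-∘₁ computable-lowIsB M) (computes-proj 0F)))) N N)
  N)
  where
  N = computes-proj 0F
  M = computes-proj 1F
  countDigits′ : ∀ {low} → Computable₁ low → Computes 1 (λ xs → countDigits low (lookup xs 0F))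
  countDigits′ computable-low = computes-∘₂ (computable-foldDigits 0 (computable₂
    (computes-∘₂ computable-+ (computes-proj 0F) (computes-∘₁ computable-low (computes-proj 1F))))) N N

foldl-+-sum : ∀ (f : Bool → ℕ) x p → foldl (λ y c → y + f c) x p ≡ x + sum (map f p)
foldl-+-sum f x []      = sym (+-identityʳ x)
foldl-+-sum f x (c ∷ p) = trans (foldl-+-sum f (x + f c) p) (+-assoc x (f c) (sum (map f p)))

countDigits-encodeLE : ∀ {low} (f : Bool → ℕ) →
                       low 0 ≡ 0 → (∀ c r → low (encodeLE (c ∷ r)) ≡ f c) →
                       ∀ p → countDigits low (encodeLE p) ≡ sum (map f p)
countDigits-encodeLE {low} f low-0 low-digit p = trans
  (foldDigits-encodeLE (λ x M → x + low M) (λ y c → y + f c)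
     (λ x → trans (cong (x +_) low-0) (+-identityʳ x)) (λ x c r → cong (x +_) (low-digit c r)) 0 p)
  (foldl-+-sum f 0 p)

ifNonzero-encodeLE : ∀ c r {x y : ℕ} → ifNonzero (encodeLE (c ∷ r)) x y ≡ x
ifNonzero-encodeLE true  r rewrite encodeLE-true r  = refl
ifNonzero-encodeLE false r rewrite encodeLE-false r = refl

lowIsB-encodeLE-first : ∀ p → lowIsB (encodeLE p) ≡ firstIsB p
lowIsB-encodeLE-first []      = refl
lowIsB-encodeLE-first (c ∷ r) = lowIsB-encodeLE c r

classOfEncoding-encodeLE : ∀ p → classOfEncoding (encodeLE p) ≡ classOf p
classOfEncoding-encodeLE p = begin
  classValue (countDigits lowIsB N) (countDigits isOdd N) (lowIsB N) (lastDigitIsB N) N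
    ≡⟨ cong₂ (λ nb na → classValue nb na (lowIsB N) (lastDigitIsB N) N)
         (countDigits-encodeLE isB refl lowIsB-encodeLE p) (countDigits-encodeLE isA refl isOdd-encodeLE p) ⟩
  classValue (countB p) (countA p) (lowIsB N) (lastDigitIsB N) N
    ≡⟨ cong₂ (λ h l → classValue (countB p) (countA p) h l N) (lowIsB-encodeLE-first p)
         (foldDigits-encodeLE (λ x M → ifNonzero M (lowIsB M) x) (λ _ c → isB c) (λ _ → refl)
            (λ x c r → trans (ifNonzero-encodeLE c r) (lowIsB-encodeLE c r)) 0 p) ⟩
  classOf p
    ∎
  where N = encodeLE p

kind-absorbʳ : ∀ m n h h′ l → (m ≡ 0 → h ≡ 0) → kind n h′ l ≢ isolated →
               kind (n + m) h l ≡ absorbing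
kind-absorbʳ m              zero                h       h′      l       _  ¬iso = ⊥-elim (¬iso refl)
kind-absorbʳ m              (suc zero)          h       zero    (suc l) _  ¬iso = ⊥-elim (¬iso refl)
kind-absorbʳ m              (suc zero)          h       (suc h′) l      _  ¬iso = ⊥-elim (¬iso refl)
kind-absorbʳ zero           (suc zero)          h       zero    zero    h0 _ rewrite h0 refl = refl
kind-absorbʳ (suc zero)     (suc zero)          zero    zero    zero    _  _ = refl
kind-absorbʳ (suc zero)     (suc zero)          (suc h) zero    zero    _  _ = refl
kind-absorbʳ (suc (suc m))  (suc zero)          h       zero    zero    _  _ = refl
kind-absorbʳ zero           (suc (suc zero))    h       h′      l       h0 _ rewrite h0 refl = refl
kind-absorbʳ (suc m)        (suc (suc zero))    h       h′      l       _  _ = refl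
kind-absorbʳ m              (suc (suc (suc n))) h       h′      l       _  _ = refl

kind-absorbˡ : ∀ m n h l l′ → (n ≡ 0 → l′ ≡ 0) → kind m h l ≢ isolated →
               kind (m + n) h l′ ≡ absorbing
kind-absorbˡ zero                n              h       l       l′ _  ¬iso = ⊥-elim (¬iso refl)
kind-absorbˡ (suc zero)          n              zero    (suc l) l′ _  ¬iso = ⊥-elim (¬iso refl)
kind-absorbˡ (suc zero)          n              (suc h) l       l′ _  ¬iso = ⊥-elim (¬iso refl)
kind-absorbˡ (suc zero)          zero           zero    zero    l′ l0 _ rewrite l0 refl = refl
kind-absorbˡ (suc zero)          (suc zero)     zero    zero    l′ _  _ = refl
kind-absorbˡ (suc zero)          (suc (suc n))  zero    zero    l′ _  _ = refl
kind-absorbˡ (suc (suc zero))    zero           zero    l       l′ _  _ = refl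
kind-absorbˡ (suc (suc zero))    zero           (suc h) l       l′ l0 _ rewrite l0 refl = refl
kind-absorbˡ (suc (suc zero))    (suc n)        h       l       l′ _  _ = refl
kind-absorbˡ (suc (suc (suc m))) n              h       l       l′ _  _ = refl

sum-map-++ : ∀ (f : Bool → ℕ) p q → sum (map f (p ++ q)) ≡ sum (map f p) + sum (map f q)
sum-map-++ f p q = trans (cong sum (map-++ f p q)) (sum-++ (map f p) (map f q))

lastIsB-++ : ∀ p d s → lastIsB (p ++ d ∷ s) ≡ lastIsB (d ∷ s)
lastIsB-++ p d s = foldl-++ (λ _ c → isB c) 0 p (d ∷ s)

firstIsB≡0 : ∀ p → countB p ≡ 0 → firstIsB p ≡ 0
firstIsB≡0 []          _ = refl
firstIsB≡0 (true ∷ p)  _ = refl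
firstIsB≡0 (false ∷ p) ()

lastIsB≡0 : ∀ p → countB p ≡ 0 → lastIsB p ≡ 0
lastIsB≡0 []          _ = refl
lastIsB≡0 (true ∷ p)  e = lastIsB≡0 p e
lastIsB≡0 (false ∷ p) ()

kindOf-absorbʳ : ∀ c r d s → kindOf (d ∷ s) ≢ isolated → kindOf (c ∷ r ++ d ∷ s) ≡ absorbing
kindOf-absorbʳ c r d s ¬iso
  rewrite sum-map-++ isB (c ∷ r) (d ∷ s) | +-comm (countB (c ∷ r)) (countB (d ∷ s))
        | lastIsB-++ (c ∷ r) d s
  = kind-absorbʳ (countB (c ∷ r)) (countB (d ∷ s)) (isB c) (isB d) (lastIsB (d ∷ s))
                 (firstIsB≡0 (c ∷ r)) ¬iso

kindOf-absorbˡ : ∀ c r d s → kindOf (c ∷ r) ≢ isolated → kindOf (c ∷ r ++ d ∷ s) ≡ absorbing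
kindOf-absorbˡ c r d s ¬iso
  rewrite sum-map-++ isB (c ∷ r) (d ∷ s) | lastIsB-++ (c ∷ r) d s
  = kind-absorbˡ (countB (c ∷ r)) (countB (d ∷ s)) (isB c) (lastIsB (c ∷ r)) (lastIsB (d ∷ s))
                 (lastIsB≡0 (d ∷ s)) ¬iso

kindValue-⊕Idω : ∀ {U} k k′ na na′ N N′ → N ≢ 0 → N′ ≢ 0 →
                 (U ⊕ Idω) (kindValue k na N) (kindValue k′ na′ N′) →
                 (k ≢ isolated × k′ ≢ isolated) ⊎ N ≡ N′
kindValue-⊕Idω isolated  isolated  _  _   _ _  _   _    r = inj₂ (⊕-odd r)
kindValue-⊕Idω isolated  inR       _  na′ N _  _   _    r = ⊥-elim (⊕-odd-even {x = N} {na′} r)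
kindValue-⊕Idω isolated  absorbing _  _   _ _  N≢0 _    r = ⊥-elim (N≢0 (⊕-odd r))
kindValue-⊕Idω inR       isolated  na _   _ N′ _   _    r = ⊥-elim (⊕-even-odd {x = na} {N′} r)
kindValue-⊕Idω absorbing isolated  _  _   _ _  _   N′≢0 r = ⊥-elim (N′≢0 (sym (⊕-odd r)))
kindValue-⊕Idω inR       inR       _  _   _ _  _   _    _ = inj₁ ((λ ()) , (λ ()))
kindValue-⊕Idω inR       absorbing _  _   _ _  _   _    _ = inj₁ ((λ ()) , (λ ()))
kindValue-⊕Idω absorbing inR       _  _   _ _  _   _    _ = inj₁ ((λ ()) , (λ ()))
kindValue-⊕Idω absorbing absorbing _  _   _ _  _   _    _ = inj₁ ((λ ()) , (λ ()))

reverse-∷ : ∀ {A : Set} (x : A) xs → ∃₂ λ y ys → reverse (x ∷ xs) ≡ y ∷ ys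
reverse-∷ x xs with reverse xs | unfold-reverse x xs
... | []     | e = x , [] , e
... | y ∷ ys | e = y , ys ∷ʳ x , e

digits : Word → List Bool
digits w = reverse (toList w)

digits-∷ : ∀ w → ∃₂ λ d ds → digits w ≡ d ∷ ds
digits-∷ (c ∷ cs) = reverse-∷ c cs

digits-⁺++⁺ : ∀ u v → digits (u ⁺++⁺ v) ≡ digits v ++ digits u
digits-⁺++⁺ u v = reverse-++ (toList u) (toList v)

digits-⁺++⁺-∷ : ∀ u v {c r d s} → digits v ≡ c ∷ r → digits u ≡ d ∷ s →
                digits (u ⁺++⁺ v) ≡ c ∷ r ++ d ∷ s
digits-⁺++⁺-∷ u v dv du = trans (digits-⁺++⁺ u v) (cong₂ _++_ dv du)

encodeAcc-ʳ++ : ∀ r L → encodeAcc (encodeLE r) L ≡ encodeLE (L ʳ++ r)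
encodeAcc-ʳ++ r []      = refl
encodeAcc-ʳ++ r (c ∷ L) = encodeAcc-ʳ++ (c ∷ r) L

encodeLE-digits≢0 : ∀ w → encodeLE (digits w) ≢ 0
encodeLE-digits≢0 w with digits-∷ w
... | d , ds , e = λ ≡0 → encodeLE-∷≢0 d ds (trans (cong encodeLE (sym e)) ≡0)

suc-code : ∀ w → suc (code w) ≡ encodeLE (digits w)
suc-code w@(c ∷ cs) = begin
  suc (code w)                     ≡⟨ cong (suc ∘ pred) (encodeAcc-ʳ++ [] (c ∷ cs)) ⟩
  suc (pred (encodeLE (digits w))) ≡⟨ suc-pred _ {{≢-nonZero (encodeLE-digits≢0 w)}} ⟩
  encodeLE (digits w)              ∎

code-surjective : ∀ m → ∃ λ w → code w ≡ m
code-surjective m with increment (decodeLE m) in inc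
... | d ∷ ds with reverse-∷ d ds
...   | e , es , rev = e ∷ es , suc-injective (begin
  suc (code (e ∷ es))                        ≡⟨ suc-code (e ∷ es) ⟩
  encodeLE (reverse (e ∷ es))                ≡⟨ cong (encodeLE ∘ reverse) rev ⟨
  encodeLE (reverse (reverse (d ∷ ds)))      ≡⟨ cong encodeLE (reverse-involutive (d ∷ ds)) ⟩
  encodeLE (d ∷ ds)                          ≡⟨ cong (encodeLE ∘ toList) inc ⟨
  encodeLE (toList (increment (decodeLE m))) ≡⟨ encodeLE-increment (decodeLE m) ⟩
  suc (encodeLE (decodeLE m))                ≡⟨ cong suc (encodeLE-decodeLE m) ⟩
  suc m                                      ∎)

WordProblem-preimage : ∀ (Q : ℕ → ℕ → Set) (κ : Word → ℕ) (g : ℕ → ℕ) →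
                       (∀ w → g (code w) ≡ κ w) →
                       ∀ m n → WordProblem (λ u v → Q (κ u) (κ v)) m n ⇔ Q (g m) (g n)
WordProblem-preimage Q κ g g∘code m n = mk⇔ to from
  where
  to : WordProblem (λ u v → Q (κ u) (κ v)) m n → Q (g m) (g n)
  to (u , v , refl , refl , q) = subst₂ Q (sym (g∘code u)) (sym (g∘code v)) q

  from : Q (g m) (g n) → WordProblem (λ u v → Q (κ u) (κ v)) m n
  from q with code-surjective m | code-surjective n
  ... | u , refl | v , refl = u , v , refl , refl , subst₂ Q (g∘code u) (g∘code v) q

classOfCode : ℕ → ℕ
classOfCode m = classOfEncoding (suc m)

computable-classOfCode : Computable classOfCode
computable-classOfCode =
  computable₁⇒computable
    (computable₁ (computes-∘₁ computable-classOfEncoding (computes-suc (computes-proj 0F))))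

classOfCode-code : ∀ w → classOfCode (code w) ≡ classOf (digits w)
classOfCode-code w = trans (cong classOfEncoding (suc-code w)) (classOfEncoding-encodeLE (digits w))

bab : ℕ → Word
bab n = false ∷ replicate n true ++ false ∷ []

replicate-∷ʳ : ∀ {A : Set} n (x : A) → replicate n x ∷ʳ x ≡ x ∷ replicate n x
replicate-∷ʳ zero    x = refl
replicate-∷ʳ (suc n) x = cong (x ∷_) (replicate-∷ʳ n x)

reverse-replicate : ∀ {A : Set} n (x : A) → reverse (replicate n x) ≡ replicate n x
reverse-replicate zero    x = refl
reverse-replicate (suc n) x = begin
  reverse (x ∷ replicate n x)   ≡⟨ unfold-reverse x (replicate n x) ⟩
  reverse (replicate n x) ∷ʳ x  ≡⟨ cong (_∷ʳ x) (reverse-replicate n x) ⟩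
  replicate n x ∷ʳ x            ≡⟨ replicate-∷ʳ n x ⟩
  x ∷ replicate n x             ∎

digits-bab : ∀ n → digits (bab n) ≡ toList (bab n)
digits-bab n = begin
  reverse (false ∷ replicate n true ++ false ∷ [])
    ≡⟨ unfold-reverse false (replicate n true ++ false ∷ []) ⟩
  reverse (replicate n true ++ false ∷ []) ∷ʳ false
    ≡⟨ cong (_∷ʳ false) (reverse-++ (replicate n true) (false ∷ [])) ⟩
  false ∷ reverse (replicate n true) ∷ʳ false
    ≡⟨ cong (λ l → false ∷ l ∷ʳ false) (reverse-replicate n true) ⟩
  false ∷ replicate n true ∷ʳ false
    ∎

code-bab : ∀ n → code (bab n) ≡ 2 * encodeLE (replicate n true ++ false ∷ []) + 1
code-bab n = suc-injective (begin
  suc (code (bab n))                                      ≡⟨ suc-code (bab n) ⟩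
  encodeLE (digits (bab n))                               ≡⟨ cong encodeLE (digits-bab n) ⟩
  2 * encodeLE (replicate n true ++ false ∷ []) + 2       ≡⟨ +-suc _ 1 ⟩
  suc (2 * encodeLE (replicate n true ++ false ∷ []) + 1) ∎)

computable-code∘bab : Computable (code ∘ bab)
computable-code∘bab = computable₁⇒computable (computable₁-rec (code ∘ bab) (λ _ r → 2 * r + 1)
  (computable₂ (computes-∘₂ computable-+ (computes-∘₁ computable-2* (computes-proj 1F)) (computes-const 1)))
  (λ n → trans (code-bab (suc n)) (cong (λ x → 2 * x + 1) (sym (code-bab n)))))

countB-replicate-true : ∀ n → countB (replicate n true) ≡ 0
countB-replicate-true zero    = refl
countB-replicate-true (suc n) = countB-replicate-true n

countA-replicate-true : ∀ n → countA (replicate n true) ≡ n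
countA-replicate-true zero    = refl
countA-replicate-true (suc n) = cong suc (countA-replicate-true n)

classOf-bab : ∀ n → classOf (toList (bab n)) ≡ 2 * n
classOf-bab n
  rewrite sum-map-++ isB (replicate n true) (false ∷ []) | countB-replicate-true n
        | lastIsB-++ (false ∷ replicate n true) false []
        | sum-map-++ isA (replicate n true) (false ∷ []) | countA-replicate-true n
  = cong (2 *_) (+-identityʳ n)

module BabSemigroup {R : ℕ → ℕ → Set} (R-isEquivalence : IsEquivalence R) where

  R⊕Idω-isEquivalence : IsEquivalence (R ⊕ Idω)
  R⊕Idω-isEquivalence = ⊕-isEquivalence R-isEquivalence isEquivalence

  _∼_ : List Bool → List Bool → Set
  _∼_ = (R ⊕ Idω) on classOf

  ∼-cases : ∀ c r d s → (c ∷ r) ∼ (d ∷ s) →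
            (kindOf (c ∷ r) ≢ isolated × kindOf (d ∷ s) ≢ isolated) ⊎ c ∷ r ≡ d ∷ s
  ∼-cases c r d s p∼q = map₂ (encodeLE-injective (c ∷ r) (d ∷ s))
    (kindValue-⊕Idω (kindOf (c ∷ r)) (kindOf (d ∷ s)) _ _ _ _
                    (encodeLE-∷≢0 c r) (encodeLE-∷≢0 d s) p∼q)

  absorbing-∼ : ∀ p q → kindOf p ≡ absorbing → kindOf q ≡ absorbing → p ∼ q
  absorbing-∼ p q kp kq = subst₂ (R ⊕ Idω)
    (cong (λ k → kindValue k (countA p) (encodeLE p)) (sym kp))
    (cong (λ k → kindValue k (countA q) (encodeLE q)) (sym kq))
    (inj₂ (0 , 0 , refl , refl , refl))

  ∼-compatible : ∀ c r c′ r′ d s d′ s′ →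
                 (c ∷ r) ∼ (c′ ∷ r′) → (d ∷ s) ∼ (d′ ∷ s′) →
                 (c ∷ r ++ d ∷ s) ∼ (c′ ∷ r′ ++ d′ ∷ s′)
  ∼-compatible c r c′ r′ d s d′ s′ p∼p′ q∼q′ with ∼-cases d s d′ s′ q∼q′
  ... | inj₁ (q≁ , q′≁) = absorbing-∼ (c ∷ r ++ d ∷ s) (c′ ∷ r′ ++ d′ ∷ s′)
      (kindOf-absorbʳ c r d s q≁) (kindOf-absorbʳ c′ r′ d′ s′ q′≁)
  ... | inj₂ refl with ∼-cases c r c′ r′ p∼p′
  ...   | inj₁ (p≁ , p′≁) = absorbing-∼ (c ∷ r ++ d ∷ s) (c′ ∷ r′ ++ d ∷ s)
      (kindOf-absorbˡ c r d s p≁) (kindOf-absorbˡ c′ r′ d s p′≁)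
  ...   | inj₂ refl = IsEquivalence.refl R⊕Idω-isEquivalence

  _≈_ : Word → Word → Set
  _≈_ = (R ⊕ Idω) on (classOf ∘ digits)

  ≈-compatible : ∀ {u u′ v v′} → u ≈ u′ → v ≈ v′ → (u ⁺++⁺ v) ≈ (u′ ⁺++⁺ v′)
  ≈-compatible {u} {u′} {v} {v′} u≈u′ v≈v′
    with digits-∷ u | digits-∷ u′ | digits-∷ v | digits-∷ v′
  ... | d , s , du | d′ , s′ , du′ | c , r , dv | c′ , r′ , dv′ =
    subst₂ _∼_ (sym (digits-⁺++⁺-∷ u v dv du)) (sym (digits-⁺++⁺-∷ u′ v′ dv′ du′))
      (∼-compatible c r c′ r′ d s d′ s′
         (subst₂ _∼_ dv dv′ v≈v′) (subst₂ _∼_ du du′ u≈u′))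

  ≈-isCongruence : IsCongruence _≈_
  ≈-isCongruence = record
    { isEquivalence = On.isEquivalence (classOf ∘ digits) R⊕Idω-isEquivalence
    ; compatible    = λ {u} {u′} {v} {v′} → ≈-compatible {u} {u′} {v} {v′}
    }

  wordProblem⇔ : ∀ m n → WordProblem _≈_ m n ⇔ (R ⊕ Idω) (classOfCode m) (classOfCode n)
  wordProblem⇔ = WordProblem-preimage (R ⊕ Idω) (classOf ∘ digits) classOfCode classOfCode-code

  wordProblem≤c⊕ : WordProblem _≈_ ≤c (R ⊕ Idω)
  wordProblem≤c⊕ = classOfCode , computable-classOfCode , wordProblem⇔

  classOfCode-bab : ∀ n → classOfCode (code (bab n)) ≡ 2 * n
  classOfCode-bab n = trans (classOfCode-code (bab n)) (trans (cong classOf (digits-bab n)) (classOf-bab n))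

  R⇔wordProblem-bab : ∀ x y → R x y ⇔ WordProblem _≈_ (code (bab x)) (code (bab y))
  R⇔wordProblem-bab x y = ⇔.trans (mk⇔ to from) (⇔.sym (wordProblem⇔ (code (bab x)) (code (bab y))))
    where
    to : R x y → (R ⊕ Idω) (classOfCode (code (bab x))) (classOfCode (code (bab y)))
    to r = subst₂ (R ⊕ Idω) (sym (classOfCode-bab x)) (sym (classOfCode-bab y))
                  (inj₁ (x , y , refl , refl , r))

    from : (R ⊕ Idω) (classOfCode (code (bab x))) (classOfCode (code (bab y))) → R x y
    from q = ⊕-even (subst₂ (R ⊕ Idω) (classOfCode-bab x) (classOfCode-bab y) q)

  ≤c-wordProblem : R ≤c WordProblem _≈_
  ≤c-wordProblem = code ∘ bab , computable-code∘bab , R⇔wordProblem-bab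

theorem3p3 : (R : ℕ → ℕ → Set) → IsCeer R → R ≡c (R ⊕ Idω) →
    Σ TwoGenCESemigroup (λ S → WordProblem (TwoGenCESemigroup._≈_ S) ≡c R)
theorem3p3 R isCeer (_ , R⊕Idω≤R) = semigroup , wordProblem≤R , ≤c-wordProblem
  where
  open BabSemigroup (IsCeer.isEquivalence isCeer)

  wordProblem≤R : WordProblem _≈_ ≤c R
  wordProblem≤R = ≤c-trans {WordProblem _≈_} {R ⊕ Idω} {R} wordProblem≤c⊕ R⊕Idω≤R

  semigroup : TwoGenCESemigroup
  semigroup = record
    { _≈_          = _≈_
    ; isCongruence = ≈-isCongruence
    ; isCE         = IsCE₂-≤c wordProblem≤R (IsCeer.isCE isCeer)
    }
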